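{- Let $t\ge 2$. Any $\overline{t}$-SSC$(n,M,q)$ is a $(t-1)$-FPC$(n,M,q)$.
   Context: An $(n,M,q)$ code is a set $\mathcal{C}\subseteq Q^n$ of $M$ distinct codewords, $|Q|=q$. For $\mathcal{C}_0\subseteq\mathcal{C}$, let $\mathcal{C}_0(i)=\{\mathbf{c}(i):\mathbf{c}\in\mathcal{C}_0\}$ and $\mathsf{desc}(\mathcal{C}_0)=\mathcal{C}_0(1)\times\cdots\times\mathcal{C}_0(n)$. $\mathcal{C}$ is a strongly $\overline{t}$-separable code ($\overline{t}$-SSC$(n,M,q)$) if for every $\mathcal{C}_0\subseteq\mathcal{C}$ with $1\le|\mathcal{C}_0|\le t$, $\bigcap_{\mathcal{C}'\in S(\mathcal{C}_0)}\mathcal{C}'=\mathcal{C}_0$, where $S(\mathcal{C}_0)=\{\mathcal{C}'\subseteq\mathcal{C}:\mathsf{desc}(\mathcal{C}')=\mathsf{desc}(\mathcal{C}_0)\}$. $\mathcal{C}$ is an $s$-frameproof code ($s$-FPC$(n,M,q)$) if for every $\mathcal{C}'\subseteq\mathcal{C}$ with $|\mathcal{C}'|\le s$, $\mathsf{desc}(\mathcal{C}')\cap\mathcal{C}=\mathcal{C}'$. -}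

module Defs where

open import Data.Nat using (ℕ; _≤_)
open import Data.Fin using (Fin)
open import Data.Fin.Subset using (Subset; _∈_; ∣_∣)
open import Data.Vec.Functional using (Vector)
open import Data.Product using (Σ; _×_; ∃)
open import Relation.Binary.PropositionalEquality using (_≡_)
open import Function.Bundles using (_⇔_)

Word : ℕ → ℕ → Set
Word n q = Vector (Fin q) n

record Code (n M q : ℕ) : Set where
  field
    word     : Fin M → Word n q
    distinct : ∀ j k → word j ≡ word k → j ≡ k
open Code public

-- A subcode C₀ ⊆ C is a subset of the index set Fin M.
-- w ∈ desc(C₀) = C₀(1) × ⋯ × C₀(n): each coordinate of w is the
-- corresponding coordinate of some codeword of C₀.
InDesc : ∀ {n M q} → Code n M q → Subset M → Word n q → Set
InDesc C C₀ w = ∀ i → ∃ λ j → j ∈ C₀ × word C j i ≡ w i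

SameDesc : ∀ {n M q} → Code n M q → Subset M → Subset M → Set
SameDesc C C' C₀ = ∀ w → InDesc C C' w ⇔ InDesc C C₀ w

-- Strongly t̄-separable: for every C₀ with 1 ≤ |C₀| ≤ t, the intersection
-- of all C' ∈ S(C₀) equals C₀ (elementwise on codeword indices).
IsSSC : ∀ {n M q} → ℕ → Code n M q → Set
IsSSC {M = M} t C =
  ∀ (C₀ : Subset M) → 1 ≤ ∣ C₀ ∣ → ∣ C₀ ∣ ≤ t →
    ∀ (j : Fin M) → ((∀ (C' : Subset M) → SameDesc C C' C₀ → j ∈ C') ⇔ j ∈ C₀)

IsFPC : ∀ {n M q} → ℕ → Code n M q → Set
IsFPC {M = M} s C =
  ∀ (C' : Subset M) → ∣ C' ∣ ≤ s →
    ∀ (j : Fin M) → (InDesc C C' (word C j) ⇔ j ∈ C')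

-- Given C' with |C'| ≤ t − 1 and a codeword c_j ∈ desc(C'), the subcode C₀ = C' ∪ {c_j}
-- has 1 ≤ |C₀| ≤ t and desc(C₀) = desc(C'), because every coordinate of c_j is already
-- supplied by C'. So C' ∈ S(C₀), and strong separability puts j, a member of C₀, into C'.
module Submission where

open import Defs
open import Data.Nat using (ℕ; _≤_; _∸_; _+_; suc; s≤s; z≤n)
open import Data.Nat.Properties using (≤-trans; ≤-reflexive; +-monoʳ-≤; +-suc; +-comm; n≤1+n)
open import Data.Bool using (true; false)
open import Data.Vec using ([]; _∷_)
open import Data.Fin using (Fin)
open import Data.Fin.Subset using (Subset; _∈_; ∣_∣; _∪_; ⁅_⁆)
open import Data.Fin.Subset.Properties
  using (x∈⁅x⁆; x∈⁅y⁆⇒x≡y; x∈p∪q⁻; x∈p∪q⁺; ∣⁅x⁆∣≡1; ∣q∣≤∣p∪q∣)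
open import Data.Product using (_,_)
open import Data.Sum using (inj₁; inj₂)
open import Function.Bundles using (mk⇔; Equivalence)
open import Relation.Binary.PropositionalEquality using (refl; sym; trans; cong; subst)

∣p∪q∣≤∣p∣+∣q∣ : ∀ {m} (p q : Subset m) → ∣ p ∪ q ∣ ≤ ∣ p ∣ + ∣ q ∣
∣p∪q∣≤∣p∣+∣q∣ []          []          = z≤n
∣p∪q∣≤∣p∣+∣q∣ (true ∷ p)  (true ∷ q)  = s≤s (≤-trans (∣p∪q∣≤∣p∣+∣q∣ p q) (+-monoʳ-≤ ∣ p ∣ (n≤1+n ∣ q ∣)))
∣p∪q∣≤∣p∣+∣q∣ (true ∷ p)  (false ∷ q) = s≤s (∣p∪q∣≤∣p∣+∣q∣ p q)
∣p∪q∣≤∣p∣+∣q∣ (false ∷ p) (true ∷ q)  =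
  subst (suc ∣ p ∪ q ∣ ≤_) (sym (+-suc ∣ p ∣ ∣ q ∣)) (s≤s (∣p∪q∣≤∣p∣+∣q∣ p q))
∣p∪q∣≤∣p∣+∣q∣ (false ∷ p) (false ∷ q) = ∣p∪q∣≤∣p∣+∣q∣ p q

∣p∪⁅x⁆∣≤1+∣p∣ : ∀ {m} (p : Subset m) (x : Fin m) → ∣ p ∪ ⁅ x ⁆ ∣ ≤ suc ∣ p ∣
∣p∪⁅x⁆∣≤1+∣p∣ p x = ≤-trans (∣p∪q∣≤∣p∣+∣q∣ p ⁅ x ⁆)
  (≤-reflexive (trans (cong (∣ p ∣ +_) (∣⁅x⁆∣≡1 x)) (+-comm ∣ p ∣ 1)))

1≤∣p∪⁅x⁆∣ : ∀ {m} (p : Subset m) (x : Fin m) → 1 ≤ ∣ p ∪ ⁅ x ⁆ ∣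
1≤∣p∪⁅x⁆∣ p x = subst (_≤ ∣ p ∪ ⁅ x ⁆ ∣) (∣⁅x⁆∣≡1 x) (∣q∣≤∣p∪q∣ p ⁅ x ⁆)

module _ {n M q} (C : Code n M q) where

  InDesc-∪⁺ˡ : ∀ {C' w} (C'' : Subset M) → InDesc C C' w → InDesc C (C' ∪ C'') w
  InDesc-∪⁺ˡ C'' w∈ i with w∈ i
  ... | k , k∈C' , eq = k , x∈p∪q⁺ (inj₁ k∈C') , eq

  SameDesc-∪⁅⁆ : ∀ C' j → InDesc C C' (word C j) → SameDesc C C' (C' ∪ ⁅ j ⁆)
  SameDesc-∪⁅⁆ C' j cⱼ∈ w = mk⇔ (InDesc-∪⁺ˡ ⁅ j ⁆) shrink
    where
    shrink : InDesc C (C' ∪ ⁅ j ⁆) w → InDesc C C' w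
    shrink w∈ i with w∈ i
    ... | k , k∈ , eq with x∈p∪q⁻ C' ⁅ j ⁆ k∈
    ...   | inj₁ k∈C' = k , k∈C' , eq
    ...   | inj₂ k∈⁅j⁆ with x∈⁅y⁆⇒x≡y j k∈⁅j⁆
    ...     | refl with cⱼ∈ i
    ...       | k' , k'∈C' , eq' = k' , k'∈C' , trans eq' eq

corollary1 : ∀ (t n M q : ℕ) → 2 ≤ t → (C : Code n M q) → IsSSC t C → IsFPC (t ∸ 1) C
corollary1 (suc t) n M q (s≤s _) C ssc C' ∣C'∣≤t j = mk⇔ fromSeparability (λ j∈C' i → j , j∈C' , refl)
  where
  C₀ : Subset M
  C₀ = C' ∪ ⁅ j ⁆

  fromSeparability : InDesc C C' (word C j) → j ∈ C'
  fromSeparability cⱼ∈ =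
    Equivalence.from (ssc C₀ (1≤∣p∪⁅x⁆∣ C' j) (≤-trans (∣p∪⁅x⁆∣≤1+∣p∣ C' j) (s≤s ∣C'∣≤t)) j)
      (x∈p∪q⁺ (inj₂ (x∈⁅x⁆ j))) C' (SameDesc-∪⁅⁆ C C' j cⱼ∈)
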